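{- Let $G$ be a connected graph, let $w$ be a weight function on $V(G)$ with $\mathrm{s}(G,w)<\mathrm{cs}(G,w)$, and let $S$ be a minimum weighted safe set of $(G,w)$ (i.e., a weighted safe set with $w(S)=\mathrm{s}(G,w)$). Then $\beta(G,S)\notin\mathcal{G}^{\mathrm{cs}}$.
   Context: All graphs are finite and simple. A weight function on $V(G)$ is a map $w:V(G)\to\mathbb{R}_{>0}$; for $X\subseteq V(G)$ put $w(X)=\sum_{v\in X}w(v)$. A non-empty set $S\subseteq V(G)$ is a weighted safe set of $(G,w)$ if for every component $C$ of the induced subgraph $G[S]$ and every component $D$ of $G-S$ such that some edge joins $C$ and $D$, we have $w(C)\ge w(D)$. It is a connected weighted safe set if moreover $G[S]$ is connected. $\mathrm{s}(G,w)$ (resp. $\mathrm{cs}(G,w)$) is the minimum of $w(S)$ over all weighted safe sets (resp. connected weighted safe sets) $S$ of $(G,w)$. $\mathcal{G}^{\mathrm{cs}}$ denotes the family of all graphs $G$ such that $\mathrm{s}(G,w)=\mathrm{cs}(G,w)$ for every weight function $w$ on $V(G)$. For a connected graph $G$ and $S\subseteq V(G)$, $\beta(G,S)$ is the graph whose vertices are the components of $G[S]$ and the components of $G-S$, two such components $A,B$ being adjacent iff some edge of $G$ joins a vertex of $A$ to a vertex of $B$.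
   Formalization: The weight function w takes values in the positive rationals rather than the positive reals, and the weight functions quantified over in the definition of $\mathcal{G}^{\mathrm{cs}}$ are likewise taken rational. -}

module Defs where

open import Data.Nat using (ℕ; zero; suc)
open import Data.Fin using (Fin; zero; suc)
open import Data.Bool using (Bool; true; false; if_then_else_)
open import Data.Vec using (Vec; []; _∷_)
open import Data.Fin.Subset using (Subset; _∈_; _⊆_; ∁; Nonempty)
open import Data.Rational using (ℚ; 0ℚ; _+_; _≤_; _<_)
open import Data.Product using (Σ; ∃; _×_; _,_)
open import Data.Sum using (_⊎_)
open import Relation.Binary.PropositionalEquality using (_≡_; _≢_)
open import Function using (_∘_)
open import Function.Bundles using (_⇔_)

record Graph : Set where
  field
    n      : ℕ
    Adj    : Fin n → Fin n → Bool
    sym    : ∀ u v → Adj u v ≡ Adj v u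
    irrefl : ∀ v → Adj v v ≡ false
open Graph public

V : Graph → Set
V G = Fin (n G)

Weight : Graph → Set
Weight G = V G → ℚ

Positive : (G : Graph) → Weight G → Set
Positive G w = ∀ v → 0ℚ < w v

wsum : ∀ {m} → (Fin m → ℚ) → Subset m → ℚ
wsum {zero}  w []      = 0ℚ
wsum {suc m} w (b ∷ X) = (if b then w zero else 0ℚ) + wsum (w ∘ suc) X

data Path (G : Graph) (X : Subset (n G)) : V G → V G → Set where
  here : ∀ {u} → u ∈ X → Path G X u u
  step : ∀ {u v x} → Path G X u v → Adj G v x ≡ true → x ∈ X → Path G X u x

ConnectedIn : (G : Graph) → Subset (n G) → Set
ConnectedIn G X = ∀ u v → u ∈ X → v ∈ X → Path G X u v

ConnectedGraph : Graph → Set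
ConnectedGraph G = ∀ (u v : V G) → Path G (Data.Fin.Subset.⊤) u v

Component : (G : Graph) → Subset (n G) → Subset (n G) → Set
Component G X C =
  C ⊆ X × Nonempty C × ConnectedIn G C
  × (∀ u v → u ∈ C → v ∈ X → Path G X u v → v ∈ C)

EdgeBetween : (G : Graph) → Subset (n G) → Subset (n G) → Set
EdgeBetween G C D = ∃ λ u → ∃ λ v → u ∈ C × v ∈ D × Adj G u v ≡ true

Safe : (G : Graph) → Weight G → Subset (n G) → Set
Safe G w S =
  Nonempty S ×
  (∀ C D → Component G S C → Component G (∁ S) D → EdgeBetween G C D
     → wsum w D ≤ wsum w C)

ConnSafe : (G : Graph) → Weight G → Subset (n G) → Set
ConnSafe G w S = Safe G w S × ConnectedIn G S

IsSafeNumber : (G : Graph) → Weight G → ℚ → Set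
IsSafeNumber G w x =
  (∃ λ S → Safe G w S × wsum w S ≡ x) × (∀ T → Safe G w T → x ≤ wsum w T)

IsConnSafeNumber : (G : Graph) → Weight G → ℚ → Set
IsConnSafeNumber G w x =
  (∃ λ S → ConnSafe G w S × wsum w S ≡ x) × (∀ T → ConnSafe G w T → x ≤ wsum w T)

MinSafe : (G : Graph) → Weight G → Subset (n G) → Set
MinSafe G w S = Safe G w S × (∀ T → Safe G w T → wsum w S ≤ wsum w T)

InGcs : Graph → Set
InGcs G = ∀ (w : Weight G) → Positive G w →
  ∃ λ x → IsSafeNumber G w x × IsConnSafeNumber G w x

SameComp : (G : Graph) → Subset (n G) → V G → V G → Set
SameComp G S u v =
  (u ∈ S × v ∈ S × Path G S u v) ⊎ (u ∈ ∁ S × v ∈ ∁ S × Path G (∁ S) u v)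

-- H together with f : V(G) → V(H) is (a copy of) β(G,S): f is the surjective
-- quotient map sending each vertex to its component (of G[S] or G-S), and
-- distinct components are adjacent iff some edge of G joins them.
IsBeta : (G : Graph) → Subset (n G) → (H : Graph) → (V G → V H) → Set
IsBeta G S H f =
  (∀ a → ∃ λ u → f u ≡ a)
  × (∀ u v → (f u ≡ f v) ⇔ SameComp G S u v)
  × (∀ a b → (Adj H a b ≡ true) ⇔
       (a ≢ b × ∃ λ u → ∃ λ v → f u ≡ a × f v ≡ b × Adj G u v ≡ true))

{-# OPTIONS --safe #-}
-- Give each vertex of β(G,S) the total weight of the component it stands for.
-- Since the map G → β(G,S) is a contraction of connected vertex sets, a set
-- X of vertices of β is safe exactly when its preimage is safe in G, the two
-- having the same weight, and connected sets have connected preimages.  The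
-- minimum safe set S is such a preimage, so s(β) ≤ w(S) = s(G) < cs(G) ≤ cs(β),
-- and β violates s = cs for this weight.
module Submission where

open import Defs
open import Data.Fin.Subset using (Subset)
open import Data.Rational using (ℚ; _<_)
open import Data.Product using (_×_)
open import Relation.Nullary using (¬_)

open import Algebra.Bundles using (CommutativeMonoid)
open import Data.Bool using (Bool; true; false; if_then_else_)
open import Data.Empty using (⊥-elim)
open import Data.Fin using (Fin; zero; suc; _≟_)
open import Data.Fin.Subset using (_∈_; _∉_; _⊆_; ∁; ⁅_⁆)
open import Data.Fin.Subset.Properties using (⊆-antisym; x∈⁅y⁆⇔x≡y; x∈∁p⇒x∉p)
open import Data.Nat using (ℕ)
open import Data.Product using (∃; _,_; proj₁; proj₂)
open import Data.Rational using (0ℚ; _+_; _≤_)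
import Data.Rational.Properties as ℚ
open import Data.Sum using (inj₁; inj₂)
open import Data.Vec using (_∷_; []; lookup; tabulate; here; there)
open import Data.Vec.Properties
  using (lookup∘tabulate; lookup⇒[]=; []=⇒lookup; lookup-map; lookup-replicate;
         tabulate-cong; tabulate-∘)
open import Function using (_∘_)
open import Function.Bundles using (_⇔_; Equivalence)
open import Relation.Nullary using (yes; no)
open import Relation.Binary.PropositionalEquality
  using (_≡_; _≢_; refl; trans; cong; cong₂; subst; subst₂; module ≡-Reasoning)
import Relation.Binary.PropositionalEquality as ≡

open import Algebra.Properties.CommutativeSemigroup
  (CommutativeMonoid.commutativeSemigroup ℚ.+-0-commutativeMonoid) using (interchange)

private
  variable
    m k : ℕ

-- Opaque so that unification can recover f and X from pre f X.
opaque
  pre : (Fin m → Fin k) → Subset k → Subset m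
  pre f X = tabulate (λ u → lookup X (f u))

fibre : (Fin m → Fin k) → Fin k → Subset m
fibre f a = pre f ⁅ a ⁆

Saturated : (Fin m → Fin k) → Subset m → Set
Saturated f X = ∀ {u v} → f u ≡ f v → u ∈ X → v ∈ X

module _ {f : Fin m → Fin k} {X : Subset k} {u : Fin m} where
  opaque
    unfolding pre

    ∈pre⁺ : f u ∈ X → u ∈ pre f X
    ∈pre⁺ fu∈X = lookup⇒[]= u _ (trans (lookup∘tabulate _ u) ([]=⇒lookup fu∈X))

    ∈pre⁻ : u ∈ pre f X → f u ∈ X
    ∈pre⁻ u∈pre = lookup⇒[]= (f u) X (trans (≡.sym (lookup∘tabulate _ u)) ([]=⇒lookup u∈pre))

∈fibre⁺ : {f : Fin m → Fin k} {u : Fin m} {a : Fin k} → f u ≡ a → u ∈ fibre f a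
∈fibre⁺ fu≡a = ∈pre⁺ (Equivalence.from x∈⁅y⁆⇔x≡y fu≡a)

∈fibre⁻ : {f : Fin m → Fin k} {u : Fin m} {a : Fin k} → u ∈ fibre f a → f u ≡ a
∈fibre⁻ u∈fibre = Equivalence.to x∈⁅y⁆⇔x≡y (∈pre⁻ u∈fibre)

opaque
  unfolding pre

  pre-∁ : (f : Fin m → Fin k) (X : Subset k) → pre f (∁ X) ≡ ∁ (pre f X)
  pre-∁ f X = trans (tabulate-cong (λ u → lookup-map (f u) _ X)) (tabulate-∘ _ _)

if-+ : ∀ (b : Bool) (p q : ℚ) →
       (if b then p + q else 0ℚ) ≡ (if b then p else 0ℚ) + (if b then q else 0ℚ)
if-+ true  p q = refl
if-+ false p q = ≡.sym (ℚ.+-identityʳ 0ℚ)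

wsum-0 : (X : Subset m) → wsum (λ _ → 0ℚ) X ≡ 0ℚ
wsum-0 []          = refl
wsum-0 (true  ∷ X) = trans (cong (0ℚ +_) (wsum-0 X)) (ℚ.+-identityʳ 0ℚ)
wsum-0 (false ∷ X) = trans (cong (0ℚ +_) (wsum-0 X)) (ℚ.+-identityʳ 0ℚ)

wsum-+ : (g h : Fin m → ℚ) (X : Subset m) →
         wsum (λ a → g a + h a) X ≡ wsum g X + wsum h X
wsum-+ g h []      = ≡.sym (ℚ.+-identityʳ 0ℚ)
wsum-+ g h (b ∷ X) =
  trans (cong₂ _+_ (if-+ b (g zero) (h zero)) (wsum-+ (g ∘ suc) (h ∘ suc) X))
        (interchange (if b then g zero else 0ℚ) (if b then h zero else 0ℚ)
                     (wsum (g ∘ suc) X) (wsum (h ∘ suc) X))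

wsum-indicator : ∀ (j : Fin m) (c : ℚ) (X : Subset m) →
                 wsum (λ a → if lookup ⁅ a ⁆ j then c else 0ℚ) X ≡ (if lookup X j then c else 0ℚ)
wsum-indicator zero    c (b ∷ X) =
  trans (cong ((if b then c else 0ℚ) +_) (wsum-0 X)) (ℚ.+-identityʳ _)
wsum-indicator (suc j) c (b ∷ X) rewrite lookup-replicate j false with b
... | true  = trans (ℚ.+-identityˡ _) (wsum-indicator j c X)
... | false = trans (ℚ.+-identityˡ _) (wsum-indicator j c X)

pushforward : (Fin m → Fin k) → (Fin m → ℚ) → Fin k → ℚ
pushforward f w a = wsum w (fibre f a)

opaque
  unfolding pre

  wsum-pre : ∀ (f : Fin m → Fin k) (w : Fin m → ℚ) (X : Subset k) →
             wsum w (pre f X) ≡ wsum (pushforward f w) X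
  wsum-pre {ℕ.zero} f w X = ≡.sym (wsum-0 X)
  wsum-pre {ℕ.suc m} f w X = begin
    (if lookup X (f zero) then w zero else 0ℚ) + wsum (w ∘ suc) (pre (f ∘ suc) X)
      ≡⟨ cong₂ _+_ (≡.sym (wsum-indicator (f zero) (w zero) X)) (wsum-pre (f ∘ suc) (w ∘ suc) X) ⟩
    wsum (λ a → if lookup ⁅ a ⁆ (f zero) then w zero else 0ℚ) X
      + wsum (pushforward (f ∘ suc) (w ∘ suc)) X
      ≡⟨ ≡.sym (wsum-+ _ (pushforward (f ∘ suc) (w ∘ suc)) X) ⟩
    wsum (pushforward f w) X ∎
    where open ≡-Reasoning

if-nonneg : ∀ (b : Bool) {q : ℚ} → 0ℚ < q → 0ℚ ≤ (if b then q else 0ℚ)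
if-nonneg true  0<q = ℚ.<⇒≤ 0<q
if-nonneg false 0<q = ℚ.≤-refl

wsum-nonneg : {w : Fin m → ℚ} → (∀ u → 0ℚ < w u) → (X : Subset m) → 0ℚ ≤ wsum w X
wsum-nonneg w>0 []      = ℚ.≤-refl
wsum-nonneg {w = w} w>0 (b ∷ X) =
  subst (_≤ wsum w (b ∷ X)) (ℚ.+-identityʳ 0ℚ)
    (ℚ.+-mono-≤ (if-nonneg b (w>0 zero)) (wsum-nonneg (w>0 ∘ suc) X))

wsum-pos : {w : Fin m → ℚ} → (∀ u → 0ℚ < w u) → {X : Subset m} {u : Fin m} → u ∈ X → 0ℚ < wsum w X
wsum-pos {w = w} w>0 {true ∷ X} here =
  subst (_< wsum w (true ∷ X)) (ℚ.+-identityʳ 0ℚ)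
    (ℚ.+-mono-<-≤ (w>0 zero) (wsum-nonneg (w>0 ∘ suc) X))
wsum-pos {w = w} w>0 {b ∷ X} (there u∈X) =
  subst (_< wsum w (b ∷ X)) (ℚ.+-identityʳ 0ℚ)
    (ℚ.+-mono-≤-< (if-nonneg b (w>0 zero)) (wsum-pos (w>0 ∘ suc) u∈X))

pushforward-pos : {f : Fin m → Fin k} {w : Fin m → ℚ} → (∀ a → ∃ λ u → f u ≡ a) →
                  (∀ u → 0ℚ < w u) → ∀ a → 0ℚ < pushforward f w a
pushforward-pos surjective w>0 a = wsum-pos w>0 (∈fibre⁺ (proj₂ (surjective a)))

module _ {G : Graph} where

  Path-end : ∀ {X u v} → Path G X u v → v ∈ X
  Path-end (here v∈X)     = v∈X
  Path-end (step _ _ v∈X) = v∈X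

  Path-trans : ∀ {X u v x} → Path G X u v → Path G X v x → Path G X u x
  Path-trans p (here _)       = p
  Path-trans p (step q e x∈X) = step (Path-trans p q) e x∈X

  Path-restrict : ∀ {X Y u v} → Path G Y u v → (∀ {z} → Path G Y u z → z ∈ X) → Path G X u v
  Path-restrict (here u∈Y)     onX = here (onX (here u∈Y))
  Path-restrict (step p e v∈Y) onX = step (Path-restrict p onX) e (onX (step p e v∈Y))

  Path-mono : ∀ {X Y u v} → X ⊆ Y → Path G X u v → Path G Y u v
  Path-mono X⊆Y p = Path-restrict p (λ q → X⊆Y (Path-end q))

record IsContraction (G H : Graph) (f : V G → V H) : Set where
  field
    surjective      : ∀ a → ∃ λ u → f u ≡ a
    fibre-connected : ∀ {u v} → f u ≡ f v → Path G (fibre f (f u)) u v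
    adjacent⇔       : ∀ a b → (Adj H a b ≡ true) ⇔
                        (a ≢ b × ∃ λ u → ∃ λ v → f u ≡ a × f v ≡ b × Adj G u v ≡ true)

module Contraction {G H : Graph} {f : V G → V H} (contraction : IsContraction G H f) where
  open IsContraction contraction public

  section : V H → V G
  section a = proj₁ (surjective a)

  f∘section : ∀ a → f (section a) ≡ a
  f∘section a = proj₂ (surjective a)

  section-∈pre⁺ : ∀ {X a} → a ∈ X → section a ∈ pre f X
  section-∈pre⁺ {X} a∈X = ∈pre⁺ (subst (_∈ X) (≡.sym (f∘section _)) a∈X)

  section-∈pre⁻ : ∀ {X a} → section a ∈ pre f X → a ∈ X
  section-∈pre⁻ {X} s∈pre = subst (_∈ X) (f∘section _) (∈pre⁻ s∈pre)

  saturated⇒pre : ∀ {X} → Saturated f X → ∃ λ K → X ≡ pre f K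
  saturated⇒pre {X} saturated = pre section X , ⊆-antisym
    (λ u∈X → ∈pre⁺ (∈pre⁺ (saturated (≡.sym (f∘section _)) u∈X)))
    (λ u∈pre → saturated (f∘section _) (∈pre⁻ (∈pre⁻ u∈pre)))

  fibre-path : ∀ {X u v} → f u ≡ f v → f u ∈ X → Path G (pre f X) u v
  fibre-path {X} fu≡fv fu∈X = Path-mono
    (λ z∈fibre → ∈pre⁺ (subst (_∈ X) (≡.sym (∈fibre⁻ z∈fibre)) fu∈X))
    (fibre-connected fu≡fv)

  lift : ∀ {X a b u v} → Path H X a b → f u ≡ a → f v ≡ b → Path G (pre f X) u v
  lift (here a∈X) refl fv≡fu = fibre-path (≡.sym fv≡fu) a∈X
  lift {X} {v = v} (step {v = c} p e fv∈X) fu≡a refl with Equivalence.to (adjacent⇔ c (f v)) e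
  ... | _ , u′ , v′ , fu′≡c , fv′≡fv , e′ =
    Path-trans (step (lift p fu≡a fu′≡c) e′ (∈pre⁺ fv′∈X)) (fibre-path fv′≡fv fv′∈X)
    where
    fv′∈X : f v′ ∈ X
    fv′∈X = subst (_∈ X) (≡.sym fv′≡fv) fv∈X

  project : ∀ {X u v} → Path G (pre f X) u v → Path H X (f u) (f v)
  project (here u∈pre) = here (∈pre⁻ u∈pre)
  project {X} {u} (step {v = v} {x} p e x∈pre) with f v ≟ f x
  ... | yes fv≡fx = subst (Path H X (f u)) fv≡fx (project p)
  ... | no fv≢fx  = step (project p)
                         (Equivalence.from (adjacent⇔ _ _) (fv≢fx , v , x , refl , refl , e))
                         (∈pre⁻ x∈pre)

  connectedIn-pre : ∀ {X} → ConnectedIn H X → ConnectedIn G (pre f X)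
  connectedIn-pre connected u v u∈ v∈ = lift (connected _ _ (∈pre⁻ u∈) (∈pre⁻ v∈)) refl refl

  component-pre⁺ : ∀ {X K} → Component H X K → Component G (pre f X) (pre f K)
  component-pre⁺ (K⊆X , (a , a∈K) , connected , closed) =
    (λ u∈ → ∈pre⁺ (K⊆X (∈pre⁻ u∈))) ,
    (section a , section-∈pre⁺ a∈K) ,
    connectedIn-pre connected ,
    (λ u v u∈K v∈X p → ∈pre⁺ (closed _ _ (∈pre⁻ u∈K) (∈pre⁻ v∈X) (project p)))

  component-pre⁻ : ∀ {X K} → Component G (pre f X) (pre f K) → Component H X K
  component-pre⁻ {K = K} (K⊆X , (u , u∈K) , connected , closed) =
    (λ a∈K → section-∈pre⁻ (K⊆X (section-∈pre⁺ a∈K))) ,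
    (f u , ∈pre⁻ u∈K) ,
    (λ a b a∈K b∈K → subst₂ (Path H K) (f∘section a) (f∘section b)
       (project (connected _ _ (section-∈pre⁺ a∈K) (section-∈pre⁺ b∈K)))) ,
    (λ a b a∈K b∈X p → section-∈pre⁻
       (closed _ _ (section-∈pre⁺ a∈K) (section-∈pre⁺ b∈X) (lift p (f∘section a) (f∘section b))))

  component-saturated : ∀ {X D} → Component G (pre f X) D → Saturated f D
  component-saturated {X} (D⊆X , _ , _ , closed) {u} {v} fu≡fv u∈D = closed _ _ u∈D (Path-end p) p
    where
    p : Path G (pre f X) u v
    p = fibre-path fu≡fv (∈pre⁻ (D⊆X u∈D))

  edge-pre⁺ : ∀ {C D} → EdgeBetween H C D → EdgeBetween G (pre f C) (pre f D)
  edge-pre⁺ (a , b , a∈C , b∈D , e) with Equivalence.to (adjacent⇔ a b) e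
  ... | _ , u , v , refl , refl , e′ = u , v , ∈pre⁺ a∈C , ∈pre⁺ b∈D , e′

  edge-pre⁻ : ∀ {C D} → (∀ {a} → a ∈ C → a ∉ D) →
              EdgeBetween G (pre f C) (pre f D) → EdgeBetween H C D
  edge-pre⁻ {D = D} disjoint (u , v , u∈C , v∈D , e) =
    f u , f v , ∈pre⁻ u∈C , ∈pre⁻ v∈D ,
    Equivalence.from (adjacent⇔ _ _) (fu≢fv , u , v , refl , refl , e)
    where
    fu≢fv : f u ≢ f v
    fu≢fv fu≡fv = disjoint (∈pre⁻ u∈C) (subst (_∈ D) (≡.sym fu≡fv) (∈pre⁻ v∈D))

  module _ {w : Weight G} {X : Subset (n H)} where

    safe-pre⁺ : Safe H (pushforward f w) X → Safe G w (pre f X)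
    safe-pre⁺ ((a , a∈X) , safe) = (section a , section-∈pre⁺ a∈X) , safe-pre
      where
      safe-pre : ∀ C D → Component G (pre f X) C → Component G (∁ (pre f X)) D →
                 EdgeBetween G C D → wsum w D ≤ wsum w C
      safe-pre C D C-comp D-comp edge
        with D-comp′ ← subst (λ Y → Component G Y D) (≡.sym (pre-∁ f X)) D-comp
        with saturated⇒pre (component-saturated C-comp) | saturated⇒pre (component-saturated D-comp′)
      ... | K , refl | L , refl =
        subst₂ _≤_ (≡.sym (wsum-pre f w L)) (≡.sym (wsum-pre f w K))
          (safe K L K-comp L-comp (edge-pre⁻ disjoint edge))
        where
        K-comp : Component H X K
        K-comp = component-pre⁻ C-comp
        L-comp : Component H (∁ X) L
        L-comp = component-pre⁻ D-comp′
        disjoint : ∀ {a} → a ∈ K → a ∉ L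
        disjoint a∈K a∈L = x∈∁p⇒x∉p (proj₁ L-comp a∈L) (proj₁ K-comp a∈K)

    safe-pre⁻ : Safe G w (pre f X) → Safe H (pushforward f w) X
    safe-pre⁻ ((u , u∈pre) , safe) = (f u , ∈pre⁻ u∈pre) , λ K L K-comp L-comp edge →
      subst₂ _≤_ (wsum-pre f w L) (wsum-pre f w K)
        (safe (pre f K) (pre f L) (component-pre⁺ K-comp)
              (subst (λ Y → Component G Y (pre f L)) (pre-∁ f X) (component-pre⁺ L-comp))
              (edge-pre⁺ edge))

    connSafe-pre : ConnSafe H (pushforward f w) X → ConnSafe G w (pre f X)
    connSafe-pre (safe , connected) = safe-pre⁺ safe , connectedIn-pre connected

  module _ {w : Weight G} where

    connSafeNumber-≤ : ∀ {y z} → IsConnSafeNumber G w y →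
                       IsConnSafeNumber H (pushforward f w) z → y ≤ z
    connSafeNumber-≤ {y} (_ , lower) ((T , T-connSafe , w′[T]≡z) , _) =
      subst (y ≤_) (trans (wsum-pre f w T) w′[T]≡z) (lower (pre f T) (connSafe-pre T-connSafe))

    safeNumber-≤ : ∀ {S z} → Saturated f S → Safe G w S →
                   IsSafeNumber H (pushforward f w) z → z ≤ wsum w S
    safeNumber-≤ saturated S-safe (_ , lower) with saturated⇒pre saturated
    ... | S′ , refl = subst (_ ≤_) (≡.sym (wsum-pre f w S′)) (lower S′ (safe-pre⁻ S-safe))

module _ {G H : Graph} {S : Subset (n G)} {f : V G → V H} where

  beta-saturated : IsBeta G S H f → Saturated f S
  beta-saturated (_ , same , _) {u} {v} fu≡fv u∈S with Equivalence.to (same u v) fu≡fv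
  ... | inj₁ (_ , v∈S , _)  = v∈S
  ... | inj₂ (u∈∁S , _ , _) = ⊥-elim (x∈∁p⇒x∉p u∈∁S u∈S)

  beta-isContraction : IsBeta G S H f → IsContraction G H f
  beta-isContraction (surjective , same , adjacent⇔) = record
    { surjective      = surjective
    ; fibre-connected = fibre-connected
    ; adjacent⇔       = adjacent⇔
    }
    where
    fibre-connected : ∀ {u v} → f u ≡ f v → Path G (fibre f (f u)) u v
    fibre-connected {u} {v} fu≡fv with Equivalence.to (same u v) fu≡fv
    ... | inj₁ (u∈S , _ , p) = Path-restrict p λ q →
      ∈fibre⁺ (≡.sym (Equivalence.from (same u _) (inj₁ (u∈S , Path-end q , q))))
    ... | inj₂ (u∉S , _ , p) = Path-restrict p λ q →
      ∈fibre⁺ (≡.sym (Equivalence.from (same u _) (inj₂ (u∉S , Path-end q , q))))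

lemma2p1 : (G : Graph) → ConnectedGraph G →
    (w : Weight G) → Positive G w →
    (x y : ℚ) → IsSafeNumber G w x → IsConnSafeNumber G w y → x < y →
    (S : Subset (n G)) → MinSafe G w S →
    (H : Graph) → (f : V G → V H) → IsBeta G S H f →
    ¬ InGcs H
lemma2p1 G _ w w>0 x y ((S₀ , S₀-safe , w[S₀]≡x) , _) y-connSafeNumber x<y S (S-safe , S-min) H f β H∈𝒢
  with H∈𝒢 (pushforward f w) (pushforward-pos (proj₁ β) w>0)
... | z , z-safeNumber , z-connSafeNumber = ℚ.<-irrefl refl (begin-strict
  y         ≤⟨ connSafeNumber-≤ y-connSafeNumber z-connSafeNumber ⟩
  z         ≤⟨ safeNumber-≤ (beta-saturated {H = H} β) S-safe z-safeNumber ⟩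
  wsum w S  ≤⟨ S-min S₀ S₀-safe ⟩
  wsum w S₀ ≡⟨ w[S₀]≡x ⟩
  x         <⟨ x<y ⟩
  y         ∎)
  where open Contraction (beta-isContraction β)
        open ℚ.≤-Reasoning
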